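{- Let $P$ be a finite poset and let $A$ and $B$ be sets of elements of $P$. Then there exist a superposet $P'$ of $P$ and subsets $A'\subseteq \operatorname{Min}(P')$ and $B'\subseteq\operatorname{Max}(P')$ such that: (1) the cover graph of $P'$ can be obtained from the cover graph of $P$ by adding some degree-$1$ vertices; (2) the height of $P'$ equals the height of $P$; (3) $B'\subseteq \operatorname{Up}_{P'}(B)$ and $A'\subseteq\operatorname{Down}_{P'}(A)$; and (4) $\dim_P(A,B)\le \dim_{P'}(A',B')$.
   Context: For a poset $P$, $\operatorname{Min}(P)$ and $\operatorname{Max}(P)$ are its sets of minimal and maximal elements. $Q\subseteq P$ (Q a subposet of P, P a superposet of Q) means the ground set of $Q$ is a subset of that of $P$ and the orders agree on it. The cover graph of $P$ is the graph on its elements where $x,y$ are adjacent if one covers the other. For a set $S$ of elements, $\operatorname{Up}_P(S)=\{y: x\le y \text{ in } P \text{ for some } x\in S\}$ and $\operatorname{Down}_P(S)=\{x: x\le y\text{ in }P\text{ for some }y\in S\}$. $\operatorname{Inc}(P)$ is the set of ordered pairs $(a,b)$ of incomparable elements of $P$. A linear extension $L$ of $P$ reverses $(a,b)\in\operatorname{Inc}(P)$ if $b<a$ in $L$; a set $I\subseteq\operatorname{Inc}(P)$ is reversible if some linear extension of $P$ reverses all its pairs. $\dim_P(I)$ is the least $d$ such that $I$ can be partitioned into $d$ reversible sets. For sets $A,B$ of elements, $\operatorname{Inc}_P(A,B)=\operatorname{Inc}(P)\cap(A\times B)$ and $\dim_P(A,B)=\dim_P(\operatorname{Inc}_P(A,B))$.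 Height is the size of a largest chain. -}

module Defs where

open import Level using (0ℓ)
open import Data.Nat using (ℕ; _≤_)
open import Data.Fin using (Fin) renaming (_<_ to _<F_)
open import Data.Product using (Σ; ∃; _×_; _,_)
open import Data.Sum using (_⊎_)
open import Relation.Nullary using (¬_)
open import Relation.Unary using (Pred)
open import Relation.Binary using (IsPartialOrder; Decidable)
open import Relation.Binary.PropositionalEquality using (_≡_; _≢_)
open import Function.Definitions using (Injective)

record FinPoset : Set₁ where
  field
    size  : ℕ
    _≤ₚ_  : Fin size → Fin size → Set
    isPartialOrder : IsPartialOrder _≡_ _≤ₚ_
    _≤ₚ?_ : Decidable _≤ₚ_

open FinPoset public

Elt : FinPoset → Set
Elt P = Fin (size P)

Subset : FinPoset → Set₁
Subset P = Pred (Elt P) 0ℓ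

Le : (P : FinPoset) → Elt P → Elt P → Set
Le P = _≤ₚ_ P

Lt : (P : FinPoset) → Elt P → Elt P → Set
Lt P x y = Le P x y × x ≢ y

Incomparable : (P : FinPoset) → Elt P → Elt P → Set
Incomparable P a b = ¬ Le P a b × ¬ Le P b a

IsMin : (P : FinPoset) → Elt P → Set
IsMin P x = ∀ y → ¬ Lt P y x

IsMax : (P : FinPoset) → Elt P → Set
IsMax P x = ∀ y → ¬ Lt P x y

Covers : (P : FinPoset) → Elt P → Elt P → Set   -- Covers P x y : y covers x
Covers P x y = Lt P x y × (∀ z → ¬ (Lt P x z × Lt P z y))

Adj : (P : FinPoset) → Elt P → Elt P → Set
Adj P x y = Covers P x y ⊎ Covers P y x

Degree1 : (P : FinPoset) → Elt P → Set
Degree1 P x = Σ (Elt P) λ z → Adj P x z × (∀ w → Adj P x w → w ≡ z)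

-- Subposets / superposets: Q ⊆ P via an injective map of ground sets
-- along which the orders agree.

record Embedding (Q P : FinPoset) : Set where
  field
    emb       : Elt Q → Elt P
    injective : Injective _≡_ _≡_ emb
    preserves : ∀ x y → Le Q x y → Le P (emb x) (emb y)
    reflects  : ∀ x y → Le P (emb x) (emb y) → Le Q x y

open Embedding public

Up : {P P' : FinPoset} → Embedding P P' → Subset P → Subset P'
Up {P} {P'} e S y = Σ (Elt P) λ x → S x × Le P' (emb e x) y

Down : {P P' : FinPoset} → Embedding P P' → Subset P → Subset P'
Down {P} {P'} e S x = Σ (Elt P) λ y → S y × Le P' x (emb e y)

CoverGraphByAddingLeaves : {P P' : FinPoset} → Embedding P P' → Set
CoverGraphByAddingLeaves {P} {P'} e =
  (∀ x y → (Adj P x y → Adj P' (emb e x) (emb e y))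
         × (Adj P' (emb e x) (emb e y) → Adj P x y))
  × (∀ z → ¬ (Σ (Elt P) λ x → emb e x ≡ z) → Degree1 P' z)

Chain : (P : FinPoset) → ℕ → Set
Chain P k = Σ (Fin k → Elt P) λ f → ∀ i j → i <F j → Lt P (f i) (f j)

IsHeight : (P : FinPoset) → ℕ → Set
IsHeight P h = Chain P h × (∀ k → Chain P k → k ≤ h)

record LinExt (P : FinPoset) : Set where
  field
    pos       : Elt P → Fin (size P)
    posInj    : Injective _≡_ _≡_ pos
    monotone  : ∀ x y → Le P x y → Data.Fin._≤_ (pos x) (pos y)

open LinExt public

Reverses : {P : FinPoset} → LinExt P → Elt P → Elt P → Set
Reverses L a b = pos L b <F pos L a

PairSet : FinPoset → Set₁
PairSet P = Elt P → Elt P → Set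

Reversible : (P : FinPoset) → PairSet P → Set
Reversible P S = Σ (LinExt P) λ L → ∀ a b → S a b → Reverses L a b

PartitionableInto : (P : FinPoset) → PairSet P → ℕ → Set
PartitionableInto P I d =
  Σ (∀ a b → I a b → Fin d) λ c →
    ∀ (i : Fin d) → Reversible P (λ a b → Σ (I a b) λ p → c a b p ≡ i)

IsDim : (P : FinPoset) → PairSet P → ℕ → Set
IsDim P I d = PartitionableInto P I d
            × (∀ d' → PartitionableInto P I d' → d ≤ d')

Inc : (P : FinPoset) → Subset P → Subset P → PairSet P
Inc P A B a b = A a × B b × Incomparable P a b

-- Hang a new leaf below every non-minimal element and above every non-maximal one.
-- A bottom leaf lies exactly below what its attachment point lies below, so that point is
-- its only neighbour in the cover graph; sending it to an element strictly below its
-- attachment point (and a top leaf to one strictly above) is strictly monotone, so no chain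
-- gets longer. Replace each a ∈ A by its bottom leaf (by a itself if a is minimal) and each
-- b ∈ B by its top leaf. These lie below a, resp. above b, and project back onto a and b, so
-- incomparable pairs stay incomparable, and a linear extension of P′ reversing (a′, b′)
-- restricts to a linear extension of P reversing (a, b). Hence every partition of
-- Inc(A′, B′) into reversible sets pulls back to one of Inc(A, B).

module Submission where

open import Defs
open import Level using (0ℓ)
open import Data.Nat using (ℕ; zero; suc; _≤_; _<_; z≤n; s≤s)
import Data.Nat as ℕ
import Data.Nat.Properties as ℕ
open import Data.Fin using (Fin; toℕ; fromℕ<) renaming (zero to fzero; suc to fsuc)
import Data.Fin as Fin
import Data.Fin.Properties as Fin
open import Data.List using (List; filter; lookup; length; allFin)
open import Data.List.Membership.Propositional.Properties using (∈-filter⁺; ∈-filter⁻; ∈-lookup; ∈-allFin)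
open import Data.List.Relation.Unary.Any using (index)
open import Data.List.Relation.Unary.Any.Properties using (lookup-index)
open import Data.Product using (Σ; ∃; _×_; _,_; proj₁; proj₂)
open import Data.Sum using (_⊎_; inj₁; inj₂)
open import Data.Sum.Properties using (inj₁-injective)
open import Data.Sum.Function.Propositional using (_⊎-↔_)
open import Data.Empty using (⊥; ⊥-elim)
open import Relation.Nullary using (¬_; Dec; yes; no; contradiction)
open import Relation.Unary using (Pred)
open import Relation.Binary using (IsPartialOrder; tri<; tri≈; tri>)
open import Relation.Binary.PropositionalEquality
  using (_≡_; _≢_; refl; sym; trans; cong; subst; subst₂; isEquivalence)
open import Function using (_∘_; _↔_; Inverse)
open import Function.Properties.Inverse using (↔-refl; ↔-trans)

record Enumeration {n : ℕ} (Q : Pred (Fin n) 0ℓ) : Set where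
  field
    card      : ℕ
    element   : Fin card → Fin n
    satisfies : ∀ i → Q (element i)
    onto      : ∀ x → Q x → ∃ λ i → element i ≡ x

enumerate : ∀ {n} (Q : Pred (Fin n) 0ℓ) → (∀ x → Dec (Q x)) → Enumeration Q
enumerate {n} Q Q? = record { card = length xs ; element = lookup xs ; satisfies = all-Q ; onto = onto }
  where
  xs : List (Fin n)
  xs = filter Q? (allFin n)
  all-Q : ∀ i → Q (lookup xs i)
  all-Q i = proj₂ (∈-filter⁻ Q? {xs = allFin n} (∈-lookup i))
  onto : ∀ x → Q x → ∃ λ i → lookup xs i ≡ x
  onto x q = index x∈xs , sym (lookup-index x∈xs)
    where x∈xs = ∈-filter⁺ Q? (∈-allFin x) q

module PosetProperties (P : FinPoset) where
  open IsPartialOrder (isPartialOrder P) public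
    using () renaming (refl to ≤-refl; reflexive to ≤-reflexive; trans to ≤-trans; antisym to ≤-antisym)

  <-≤-trans : ∀ {x y z} → Lt P x y → Le P y z → Lt P x z
  <-≤-trans (x≤y , x≢y) y≤z =
    ≤-trans x≤y y≤z , λ { refl → x≢y (≤-antisym x≤y y≤z) }

  ≤-<-trans : ∀ {x y z} → Le P x y → Lt P y z → Lt P x z
  ≤-<-trans x≤y (y≤z , y≢z) =
    ≤-trans x≤y y≤z , λ { refl → y≢z (≤-antisym y≤z x≤y) }

  <-trans : ∀ {x y z} → Lt P x y → Lt P y z → Lt P x z
  <-trans x<y (y≤z , _) = <-≤-trans x<y y≤z

  _<?_ : ∀ x y → Dec (Lt P x y)
  x <? y with _≤ₚ?_ P x y | x Fin.≟ y
  ... | yes x≤y | no x≢y = yes (x≤y , x≢y)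
  ... | yes _   | yes x≡y = no λ (_ , x≢y) → x≢y x≡y
  ... | no x≰y  | _       = no λ (x≤y , _) → x≰y x≤y

emb-mono-< : ∀ {Q P} (e : Embedding Q P) {x y} → Lt Q x y → Lt P (emb e x) (emb e y)
emb-mono-< e (x≤y , x≢y) = preserves e _ _ x≤y , x≢y ∘ injective e

isHeight-transfer : ∀ {P Q h} (e : Embedding P Q) (g : Elt Q → Elt P) →
  (∀ x y → Lt Q x y → Lt P (g x) (g y)) → IsHeight P h → IsHeight Q h
isHeight-transfer e g g-mono ((c , c-mono) , bound) =
  (emb e ∘ c , λ i j i<j → emb-mono-< e (c-mono i j i<j)) ,
  λ { k (c′ , c′-mono) → bound k (g ∘ c′ , λ i j i<j → g-mono _ _ (c′-mono i j i<j)) }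

-- Linear extensions restrict to subposets

countBelow : ∀ m → (Fin m → ℕ) → ℕ → ℕ
countBelow zero    f k = 0
countBelow (suc m) f k with f fzero ℕ.<? k
... | yes _ = suc (countBelow m (f ∘ fsuc) k)
... | no _  = countBelow m (f ∘ fsuc) k

countBelow-≤ : ∀ m f k → countBelow m f k ≤ m
countBelow-≤ zero    f k = z≤n
countBelow-≤ (suc m) f k with f fzero ℕ.<? k
... | yes _ = s≤s (countBelow-≤ m (f ∘ fsuc) k)
... | no _  = ℕ.m≤n⇒m≤1+n (countBelow-≤ m (f ∘ fsuc) k)

countBelow-mono : ∀ m f {k k′} → k ≤ k′ → countBelow m f k ≤ countBelow m f k′
countBelow-mono zero    f k≤k′ = z≤n
countBelow-mono (suc m) f {k} {k′} k≤k′ with f fzero ℕ.<? k | f fzero ℕ.<? k′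
... | yes _   | yes _    = s≤s (countBelow-mono m (f ∘ fsuc) k≤k′)
... | yes f<k | no f≮k′  = contradiction (ℕ.<-≤-trans f<k k≤k′) f≮k′
... | no _    | yes _    = ℕ.m≤n⇒m≤1+n (countBelow-mono m (f ∘ fsuc) k≤k′)
... | no _    | no _     = countBelow-mono m (f ∘ fsuc) k≤k′

countBelow-< : ∀ m f {k k′} (x : Fin m) → k ≤ f x → f x < k′ →
  countBelow m f k < countBelow m f k′
countBelow-< (suc m) f {k} {k′} x k≤fx fx<k′ with f fzero ℕ.<? k | f fzero ℕ.<? k′ | x
... | yes f<k | _        | fzero  = contradiction (ℕ.<-≤-trans f<k k≤fx) (ℕ.<-irrefl refl)
... | no _    | yes f<k′ | fzero  = s≤s (countBelow-mono m (f ∘ fsuc) (ℕ.<⇒≤ (ℕ.≤-<-trans k≤fx fx<k′)))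
... | no _    | no f≮k′  | fzero  = contradiction fx<k′ f≮k′
... | yes _   | yes _    | fsuc y = s≤s (countBelow-< m (f ∘ fsuc) y k≤fx fx<k′)
... | yes f<k | no f≮k′  | fsuc y = contradiction (ℕ.<-trans f<k (ℕ.≤-<-trans k≤fx fx<k′)) f≮k′
... | no _    | yes _    | fsuc y = ℕ.m≤n⇒m≤1+n (countBelow-< m (f ∘ fsuc) y k≤fx fx<k′)
... | no _    | no _     | fsuc y = countBelow-< m (f ∘ fsuc) y k≤fx fx<k′

module Ranking {m : ℕ} (f : Fin m → ℕ) where

  rank : Fin m → Fin m
  rank x = fromℕ< (ℕ.<-≤-trans (countBelow-< m f x ℕ.≤-refl (ℕ.n<1+n (f x)))
                               (countBelow-≤ m f (suc (f x))))

  toℕ-rank : ∀ x → toℕ (rank x) ≡ countBelow m f (f x)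
  toℕ-rank x = Fin.toℕ-fromℕ< _

  rank-mono-< : ∀ {x y} → f x < f y → rank x Fin.< rank y
  rank-mono-< {x} {y} fx<fy =
    subst₂ _<_ (sym (toℕ-rank x)) (sym (toℕ-rank y)) (countBelow-< m f x ℕ.≤-refl fx<fy)

  rank-mono-≤ : ∀ {x y} → f x ≤ f y → rank x Fin.≤ rank y
  rank-mono-≤ {x} {y} fx≤fy =
    subst₂ _≤_ (sym (toℕ-rank x)) (sym (toℕ-rank y)) (countBelow-mono m f fx≤fy)

  rank-injective : (∀ {x y} → f x ≡ f y → x ≡ y) → ∀ {x y} → rank x ≡ rank y → x ≡ y
  rank-injective f-inj {x} {y} rx≡ry with ℕ.<-cmp (f x) (f y)
  ... | tri< fx<fy _ _ = contradiction (cong toℕ rx≡ry) (ℕ.<⇒≢ (rank-mono-< fx<fy))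
  ... | tri≈ _ fx≡fy _ = f-inj fx≡fy
  ... | tri> _ _ fy<fx = contradiction (cong toℕ (sym rx≡ry)) (ℕ.<⇒≢ (rank-mono-< fy<fx))

module _ {Q P : FinPoset} (e : Embedding Q P) (L : LinExt P) where

  private
    position : Elt Q → ℕ
    position = toℕ ∘ pos L ∘ emb e
    open Ranking position

  restrict : LinExt Q
  restrict = record
    { pos      = rank
    ; posInj   = rank-injective (injective e ∘ posInj L ∘ Fin.toℕ-injective)
    ; monotone = λ x y x≤y → rank-mono-≤ (monotone L _ _ (preserves e x y x≤y))
    }

  restrict-reverses : ∀ {a b} → Reverses L (emb e a) (emb e b) → Reverses restrict a b
  restrict-reverses = rank-mono-<

partitionable-pullback : ∀ {P P′ I I′ d} (e : Embedding P P′) (α β : Elt P → Elt P′) →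
  (∀ a → Le P′ (α a) (emb e a)) → (∀ b → Le P′ (emb e b) (β b)) →
  (∀ a b → I a b → I′ (α a) (β b)) →
  PartitionableInto P′ I′ d → PartitionableInto P I d
partitionable-pullback e α β α≤e e≤β I⇒I′ (colour , reversible) =
  (λ a b p → colour (α a) (β b) (I⇒I′ a b p)) , λ i →
    let L , reverses = reversible i in
    restrict e L , λ a b (p , colour≡i) →
      restrict-reverses e L
        (ℕ.≤-<-trans (monotone L _ _ (e≤β b))
          (ℕ.<-≤-trans (reverses (α a) (β b) (I⇒I′ a b p , colour≡i))
                       (monotone L _ _ (α≤e a))))

isDim-mono : ∀ {P P′ I I′ d d′} (e : Embedding P P′) (α β : Elt P → Elt P′) →
  (∀ a → Le P′ (α a) (emb e a)) → (∀ b → Le P′ (emb e b) (β b)) →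
  (∀ a b → I a b → I′ (α a) (β b)) →
  IsDim P I d → IsDim P′ I′ d′ → d ≤ d′
isDim-mono e α β α≤e e≤β I⇒I′ (_ , minimal) (partition′ , _) =
  minimal _ (partitionable-pullback e α β α≤e e≤β I⇒I′ partition′)

-- Posets on a type in bijection with Fin N

module FinitePoset {V : Set} (_⊑_ : V → V → Set) (isPO : IsPartialOrder _≡_ _⊑_)
                   (_⊑?_ : ∀ u v → Dec (u ⊑ v)) {N : ℕ} (iso : Fin N ↔ V) where
  open Inverse iso public using () renaming (to to decode; from to encode;
    strictlyInverseˡ to decode-encode; strictlyInverseʳ to encode-decode)
  open IsPartialOrder isPO using () renaming (refl to ⊑-refl; trans to ⊑-trans; antisym to ⊑-antisym)

  decode-injective : ∀ {z w} → decode z ≡ decode w → z ≡ w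
  decode-injective {z} {w} eq = trans (sym (encode-decode z)) (trans (cong encode eq) (encode-decode w))

  poset : FinPoset
  poset = record
    { size  = N
    ; _≤ₚ_  = λ z w → decode z ⊑ decode w
    ; isPartialOrder = record
      { isPreorder = record
        { isEquivalence = isEquivalence
        ; reflexive     = λ { refl → ⊑-refl }
        ; trans         = ⊑-trans }
      ; antisym = λ z≤w w≤z → decode-injective (⊑-antisym z≤w w≤z) }
    ; _≤ₚ?_ = λ z w → decode z ⊑? decode w
    }

  _⊏_ : V → V → Set
  u ⊏ v = u ⊑ v × u ≢ v

  CoversV : V → V → Set
  CoversV u v = u ⊏ v × (∀ t → ¬ (u ⊏ t × t ⊏ v))

  AdjV : V → V → Set
  AdjV u v = CoversV u v ⊎ CoversV v u

  decode-encode₂ : ∀ (R : V → V → Set) {u v} → R u v → R (decode (encode u)) (decode (encode v))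
  decode-encode₂ R {u} {v} = subst₂ R (sym (decode-encode u)) (sym (decode-encode v))

  decode-encode₂⁻¹ : ∀ (R : V → V → Set) {u v} → R (decode (encode u)) (decode (encode v)) → R u v
  decode-encode₂⁻¹ R {u} {v} = subst₂ R (decode-encode u) (decode-encode v)

  ⊑⇒≤ : ∀ u v → u ⊑ v → Le poset (encode u) (encode v)
  ⊑⇒≤ u v = decode-encode₂ _⊑_

  ≤⇒⊑ : ∀ u v → Le poset (encode u) (encode v) → u ⊑ v
  ≤⇒⊑ u v = decode-encode₂⁻¹ _⊑_

  <⇒⊏ : ∀ {z w} → Lt poset z w → decode z ⊏ decode w
  <⇒⊏ (z≤w , z≢w) = z≤w , z≢w ∘ decode-injective

  ⊏⇒< : ∀ {z w} → decode z ⊏ decode w → Lt poset z w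
  ⊏⇒< (z≤w , z≢w) = z≤w , z≢w ∘ cong decode

  covers-intro : ∀ {u v} → u ⊏ v → (∀ t → u ⊏ t → v ⊑ t) → CoversV u v
  covers-intro u⊏v least = u⊏v , λ t (u⊏t , (t⊑v , t≢v)) → t≢v (⊑-antisym t⊑v (least t u⊏t))

  covers-intro′ : ∀ {u v} → u ⊏ v → (∀ t → t ⊏ v → t ⊑ u) → CoversV u v
  covers-intro′ u⊏v greatest = u⊏v , λ t ((u⊑t , u≢t) , t⊏v) → u≢t (⊑-antisym u⊑t (greatest t t⊏v))

  covers-≡ : ∀ {u v c} → CoversV u v → u ⊏ c → c ⊑ v → c ≡ v
  covers-≡ {v = v} {c} (_ , nothing-between) u⊏c c⊑v with v ⊑? c
  ... | yes v⊑c = ⊑-antisym c⊑v v⊑c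
  ... | no v⋢c  = ⊥-elim (nothing-between c (u⊏c , c⊑v , λ { refl → v⋢c ⊑-refl }))

  covers-≡′ : ∀ {u v c} → CoversV u v → c ⊏ v → u ⊑ c → c ≡ u
  covers-≡′ {u = u} {c = c} (_ , nothing-between) c⊏v u⊑c with c ⊑? u
  ... | yes c⊑u = ⊑-antisym c⊑u u⊑c
  ... | no c⋢u  = ⊥-elim (nothing-between c ((u⊑c , λ { refl → c⋢u ⊑-refl }) , c⊏v))

  isMin-encode : ∀ {u} → (∀ t → ¬ t ⊏ u) → IsMin poset (encode u)
  isMin-encode {u} minimal y y<u = minimal (decode y) (subst (decode y ⊏_) (decode-encode u) (<⇒⊏ y<u))

  isMax-encode : ∀ {u} → (∀ t → ¬ u ⊏ t) → IsMax poset (encode u)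
  isMax-encode {u} maximal y u<y = maximal (decode y) (subst (_⊏ decode y) (decode-encode u) (<⇒⊏ u<y))

  covers-decode : ∀ {z w} → Covers poset z w → CoversV (decode z) (decode w)
  covers-decode (z<w , nothing-between) =
    <⇒⊏ z<w , λ t (z⊏t , t⊏w) → nothing-between (encode t)
      (⊏⇒< (subst (_ ⊏_) (sym (decode-encode t)) z⊏t) , ⊏⇒< (subst (_⊏ _) (sym (decode-encode t)) t⊏w))

  covers-encode : ∀ {u v} → CoversV u v → Covers poset (encode u) (encode v)
  covers-encode {u} {v} (u⊏v , nothing-between) =
    ⊏⇒< (decode-encode₂ _⊏_ u⊏v) , λ z (u<z , z<v) → nothing-between (decode z)
      (subst (_⊏ _) (decode-encode u) (<⇒⊏ u<z) , subst (_ ⊏_) (decode-encode v) (<⇒⊏ z<v))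

  adj-encode : ∀ {u v} → AdjV u v → Adj poset (encode u) (encode v)
  adj-encode (inj₁ u⋖v) = inj₁ (covers-encode u⋖v)
  adj-encode (inj₂ v⋖u) = inj₂ (covers-encode v⋖u)

  adj-decode : ∀ {z w} → Adj poset z w → AdjV (decode z) (decode w)
  adj-decode (inj₁ z⋖w) = inj₁ (covers-decode z⋖w)
  adj-decode (inj₂ w⋖z) = inj₂ (covers-decode w⋖z)

  degree1-encode : ∀ {u} c → AdjV u c → (∀ v → AdjV u v → v ≡ c) → Degree1 poset (encode u)
  degree1-encode {u} c u~c unique = encode c , adj-encode u~c , λ w u~w →
    trans (sym (encode-decode w))
          (cong encode (unique (decode w) (subst (λ t → AdjV t (decode w)) (decode-encode u) (adj-decode u~w))))

-- Attaching leaves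

module LeafExtension (P : FinPoset) where
  open PosetProperties P

  NonMinimal NonMaximal : Elt P → Set
  NonMinimal x = ∃ λ y → Lt P y x
  NonMaximal x = ∃ λ y → Lt P x y

  nonMinimal? : ∀ x → Dec (NonMinimal x)
  nonMinimal? x = Fin.any? (_<? x)

  nonMaximal? : ∀ x → Dec (NonMaximal x)
  nonMaximal? x = Fin.any? (x <?_)

  module Lower = Enumeration (enumerate NonMinimal nonMinimal?)
  module Upper = Enumeration (enumerate NonMaximal nonMaximal?)

  V : Set
  V = Elt P ⊎ (Fin Lower.card ⊎ Fin Upper.card)

  pattern orig x = inj₁ x
  pattern bot i = inj₂ (inj₁ i)
  pattern top j = inj₂ (inj₂ j)

  _⊑_ : V → V → Set
  orig x ⊑ orig y = Le P x y
  orig x ⊑ top j  = Le P x (Upper.element j)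
  bot i  ⊑ orig y = Le P (Lower.element i) y
  bot i  ⊑ bot i′ = i ≡ i′
  bot i  ⊑ top j  = Le P (Lower.element i) (Upper.element j)
  top j  ⊑ top j′ = j ≡ j′
  _      ⊑ _      = ⊥

  _⊑?_ : ∀ u v → Dec (u ⊑ v)
  orig x ⊑? orig y = _≤ₚ?_ P x y
  orig x ⊑? top j  = _≤ₚ?_ P x (Upper.element j)
  bot i  ⊑? orig y = _≤ₚ?_ P (Lower.element i) y
  bot i  ⊑? bot i′ = i Fin.≟ i′
  bot i  ⊑? top j  = _≤ₚ?_ P (Lower.element i) (Upper.element j)
  top j  ⊑? top j′ = j Fin.≟ j′
  orig x ⊑? bot i  = no λ ()
  top j  ⊑? orig y = no λ ()
  top j  ⊑? bot i  = no λ ()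

  ⊑-refl : ∀ u → u ⊑ u
  ⊑-refl (orig x) = ≤-refl
  ⊑-refl (bot i)  = refl
  ⊑-refl (top j)  = refl

  ⊑-trans : ∀ u v w → u ⊑ v → v ⊑ w → u ⊑ w
  ⊑-trans (orig x) (orig y) (orig z) p q    = ≤-trans p q
  ⊑-trans (orig x) (orig y) (top k)  p q    = ≤-trans p q
  ⊑-trans (orig x) (top j)  (top k)  p refl = p
  ⊑-trans (bot i)  (orig y) (orig z) p q    = ≤-trans p q
  ⊑-trans (bot i)  (orig y) (top k)  p q    = ≤-trans p q
  ⊑-trans (bot i)  (bot j)  w        refl q = q
  ⊑-trans (bot i)  (top j)  (top k)  p refl = p
  ⊑-trans (top i)  (top j)  w        refl q = q

  ⊑-antisym : ∀ u v → u ⊑ v → v ⊑ u → u ≡ v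
  ⊑-antisym (orig x) (orig y) p q = cong orig (≤-antisym p q)
  ⊑-antisym (bot i)  (bot j)  p q = cong bot p
  ⊑-antisym (top i)  (top j)  p q = cong top p
  ⊑-antisym (orig x) (bot j)  () _
  ⊑-antisym (orig x) (top j)  _ ()
  ⊑-antisym (bot i)  (orig y) _ ()
  ⊑-antisym (bot i)  (top j)  _ ()
  ⊑-antisym (top i)  (orig y) () _
  ⊑-antisym (top i)  (bot j)  () _

  ⊑-isPartialOrder : IsPartialOrder _≡_ _⊑_
  ⊑-isPartialOrder = record
    { isPreorder = record
      { isEquivalence = isEquivalence
      ; reflexive     = λ { {u} refl → ⊑-refl u }
      ; trans         = λ {u} {v} {w} → ⊑-trans u v w }
    ; antisym = λ {u} {v} → ⊑-antisym u v }

  iso : Fin (size P ℕ.+ (Lower.card ℕ.+ Upper.card)) ↔ V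
  iso = ↔-trans Fin.+↔⊎ (↔-refl ⊎-↔ Fin.+↔⊎)

  open FinitePoset _⊑_ ⊑-isPartialOrder _⊑?_ iso public

  embedding : Embedding P poset
  embedding = record
    { emb       = encode ∘ orig
    ; injective = λ eq → inj₁-injective (decode-encode₂⁻¹ _≡_ (cong decode eq))
    ; preserves = λ x y → ⊑⇒≤ (orig x) (orig y)
    ; reflects  = λ x y → ≤⇒⊑ (orig x) (orig y) }

  orig-⊏ : ∀ {x y} → Lt P x y → orig x ⊏ orig y
  orig-⊏ (x≤y , x≢y) = x≤y , λ { refl → x≢y refl }

  ⊏-orig : ∀ {x y} → orig x ⊏ orig y → Lt P x y
  ⊏-orig (x≤y , x≢y) = x≤y , x≢y ∘ cong orig

  covers-orig : ∀ {x y} → Covers P x y → CoversV (orig x) (orig y)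
  covers-orig (x<y , nothing-between) = orig-⊏ x<y , between
    where
    between : ∀ t → ¬ (orig _ ⊏ t × t ⊏ orig _)
    between (orig z) (x⊏z , z⊏y) = nothing-between z (⊏-orig x⊏z , ⊏-orig z⊏y)
    between (bot i)  ((() , _) , _)
    between (top j)  (_ , (() , _))

  orig-covers : ∀ {x y} → CoversV (orig x) (orig y) → Covers P x y
  orig-covers (x⊏y , nothing-between) =
    ⊏-orig x⊏y , λ z (x<z , z<y) → nothing-between (orig z) (orig-⊏ x<z , orig-⊏ z<y)

  adj-orig : ∀ {x y} → Adj P x y → AdjV (orig x) (orig y)
  adj-orig (inj₁ x⋖y) = inj₁ (covers-orig x⋖y)
  adj-orig (inj₂ y⋖x) = inj₂ (covers-orig y⋖x)

  orig-adj : ∀ {x y} → AdjV (orig x) (orig y) → Adj P x y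
  orig-adj (inj₁ x⋖y) = inj₁ (orig-covers x⋖y)
  orig-adj (inj₂ y⋖x) = inj₂ (orig-covers y⋖x)

  base : V → Elt P
  base (orig x) = x
  base (bot i)  = Lower.element i
  base (top j)  = Upper.element j

  base-mono : ∀ u v → u ⊑ v → Le P (base u) (base v)
  base-mono (orig x) (orig y) p    = p
  base-mono (orig x) (top j)  p    = p
  base-mono (bot i)  (orig y) p    = p
  base-mono (bot i)  (bot j)  refl = ≤-refl
  base-mono (bot i)  (top j)  p    = p
  base-mono (top j)  (top k)  refl = ≤-refl

  squash : V → Elt P
  squash (orig x) = x
  squash (bot i)  = proj₁ (Lower.satisfies i)
  squash (top j)  = proj₁ (Upper.satisfies j)

  squash-mono-< : ∀ u v → u ⊏ v → Lt P (squash u) (squash v)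
  squash-mono-< (orig x) (orig y) x⊏y      = ⊏-orig x⊏y
  squash-mono-< (orig x) (top j)  (p , _)  = ≤-<-trans p (proj₂ (Upper.satisfies j))
  squash-mono-< (bot i)  (orig y) (p , _)  = <-≤-trans (proj₂ (Lower.satisfies i)) p
  squash-mono-< (bot i)  (top j)  (p , _)  =
    <-trans (<-≤-trans (proj₂ (Lower.satisfies i)) p) (proj₂ (Upper.satisfies j))
  squash-mono-< (bot i)  (bot j)  (refl , i≢j) = ⊥-elim (i≢j refl)
  squash-mono-< (top i)  (top j)  (refl , i≢j) = ⊥-elim (i≢j refl)
  squash-mono-< (orig x) (bot j)  (() , _)
  squash-mono-< (top i)  (orig y) (() , _)
  squash-mono-< (top i)  (bot j)  (() , _)

  bot-minimal : ∀ i t → ¬ t ⊏ bot i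
  bot-minimal i (orig x) (() , _)
  bot-minimal i (bot j)  (refl , j≢i) = j≢i refl
  bot-minimal i (top j)  (() , _)

  top-maximal : ∀ j t → ¬ top j ⊏ t
  top-maximal j (orig x) (() , _)
  top-maximal j (bot i)  (() , _)
  top-maximal j (top k)  (refl , j≢k) = j≢k refl

  bot-⊏ : ∀ i t → bot i ⊏ t → orig (Lower.element i) ⊑ t
  bot-⊏ i (orig y) (p , _)       = p
  bot-⊏ i (bot j)  (refl , i≢j)  = ⊥-elim (i≢j refl)
  bot-⊏ i (top j)  (p , _)       = p

  ⊏-top : ∀ j t → t ⊏ top j → t ⊑ orig (Upper.element j)
  ⊏-top j (orig x) (p , _)       = p
  ⊏-top j (bot i)  (p , _)       = p
  ⊏-top j (top k)  (refl , k≢j)  = ⊥-elim (k≢j refl)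

  bot-degree1 : ∀ i → Degree1 poset (encode (bot i))
  bot-degree1 i = degree1-encode (orig (Lower.element i)) (inj₁ covered) unique
    where
    bot⊏orig : bot i ⊏ orig (Lower.element i)
    bot⊏orig = ≤-refl , λ ()
    covered : CoversV (bot i) (orig (Lower.element i))
    covered = covers-intro bot⊏orig (bot-⊏ i)
    unique : ∀ v → AdjV (bot i) v → v ≡ orig (Lower.element i)
    unique v (inj₁ i⋖v) = sym (covers-≡ i⋖v bot⊏orig (bot-⊏ i v (proj₁ i⋖v)))
    unique v (inj₂ v⋖i) = ⊥-elim (bot-minimal i v (proj₁ v⋖i))

  top-degree1 : ∀ j → Degree1 poset (encode (top j))
  top-degree1 j = degree1-encode (orig (Upper.element j)) (inj₂ covered) unique
    where
    orig⊏top : orig (Upper.element j) ⊏ top j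
    orig⊏top = ≤-refl , λ ()
    covered : CoversV (orig (Upper.element j)) (top j)
    covered = covers-intro′ orig⊏top (⊏-top j)
    unique : ∀ v → AdjV (top j) v → v ≡ orig (Upper.element j)
    unique v (inj₁ j⋖v) = ⊥-elim (top-maximal j v (proj₁ j⋖v))
    unique v (inj₂ v⋖j) = sym (covers-≡′ v⋖j orig⊏top (⊏-top j v (proj₁ v⋖j)))

  coverGraphByAddingLeaves : CoverGraphByAddingLeaves embedding
  coverGraphByAddingLeaves =
    (λ x y → adj-encode ∘ adj-orig , orig-adj ∘ decode-encode₂⁻¹ AdjV ∘ adj-decode) , new-degree1
    where
    new-degree1 : ∀ z → ¬ (∃ λ x → encode (orig x) ≡ z) → Degree1 poset z
    new-degree1 z not-orig = subst (Degree1 poset) (encode-decode z)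
      (leaf-degree1 (decode z) λ x eq → not-orig (x , trans (cong encode (sym eq)) (encode-decode z)))
      where
      leaf-degree1 : ∀ v → (∀ x → v ≢ orig x) → Degree1 poset (encode v)
      leaf-degree1 (orig x) v≢orig = ⊥-elim (v≢orig x refl)
      leaf-degree1 (bot i)  _      = bot-degree1 i
      leaf-degree1 (top j)  _      = top-degree1 j

  isHeight-preserved : ∀ h → IsHeight P h → IsHeight poset h
  isHeight-preserved _ =
    isHeight-transfer embedding (squash ∘ decode) (λ z w z<w → squash-mono-< _ _ (<⇒⊏ z<w))

  record Lowering (a : Elt P) : Set where
    field
      vertex         : V
      base-vertex    : base vertex ≡ a
      vertex-⊑       : vertex ⊑ orig a
      vertex-minimal : ∀ t → ¬ t ⊏ vertex

  record Raising (b : Elt P) : Set where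
    field
      vertex         : V
      base-vertex    : base vertex ≡ b
      vertex-⊒       : orig b ⊑ vertex
      vertex-maximal : ∀ t → ¬ vertex ⊏ t

  lower : ∀ a → Lowering a
  lower a with nonMinimal? a
  ... | yes nonMinimal = let i , i↦a = Lower.onto a nonMinimal in
    record { vertex = bot i ; base-vertex = i↦a ; vertex-⊑ = ≤-reflexive i↦a
           ; vertex-minimal = λ t → bot-minimal i t }
  ... | no minimal =
    record { vertex = orig a ; base-vertex = refl ; vertex-⊑ = ≤-refl
           ; vertex-minimal = λ t t⊏a → minimal (squash t , squash-mono-< t (orig a) t⊏a) }

  raise : ∀ b → Raising b
  raise b with nonMaximal? b
  ... | yes nonMaximal = let j , j↦b = Upper.onto b nonMaximal in
    record { vertex = top j ; base-vertex = j↦b ; vertex-⊒ = ≤-reflexive (sym j↦b)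
           ; vertex-maximal = λ t → top-maximal j t }
  ... | no maximal =
    record { vertex = orig b ; base-vertex = refl ; vertex-⊒ = ≤-refl
           ; vertex-maximal = λ t b⊏t → maximal (squash t , squash-mono-< (orig b) t b⊏t) }

  lowered raised : Elt P → Elt poset
  lowered a = encode (Lowering.vertex (lower a))
  raised b  = encode (Raising.vertex (raise b))

  lowered-≤ : ∀ a → Le poset (lowered a) (emb embedding a)
  lowered-≤ a = ⊑⇒≤ (Lowering.vertex (lower a)) (orig a) (Lowering.vertex-⊑ (lower a))

  raised-≥ : ∀ b → Le poset (emb embedding b) (raised b)
  raised-≥ b = ⊑⇒≤ (orig b) (Raising.vertex (raise b)) (Raising.vertex-⊒ (raise b))

  incomparable-lowered-raised : ∀ {a b} → Incomparable P a b →
    Incomparable poset (lowered a) (raised b)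
  incomparable-lowered-raised {a} {b} (a≰b , b≰a) =
    (λ a≤b → a≰b (subst₂ (Le P) base-a base-b (base-mono u v (≤⇒⊑ u v a≤b)))) ,
    (λ b≤a → b≰a (subst₂ (Le P) base-b base-a (base-mono v u (≤⇒⊑ v u b≤a))))
    where
    open Lowering (lower a) using () renaming (vertex to u; base-vertex to base-a)
    open Raising (raise b) using () renaming (vertex to v; base-vertex to base-b)

lemma2 : (P : FinPoset) (A B : Subset P) →
    Σ FinPoset λ P' → Σ (Embedding P P') λ e →
    Σ (Subset P') λ A' → Σ (Subset P') λ B' →
      (∀ x → A' x → IsMin P' x)
      × (∀ x → B' x → IsMax P' x)
      × CoverGraphByAddingLeaves e
      × (∀ h → IsHeight P h → IsHeight P' h)
      × (∀ x → B' x → Up e B x)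
      × (∀ x → A' x → Down e A x)
      × (∀ d d' → IsDim P (Inc P A B) d → IsDim P' (Inc P' A' B') d' → d ≤ d')
lemma2 P A B =
  poset , embedding , A′ , B′ ,
  (λ { _ (a , _ , refl) → isMin-encode (Lowering.vertex-minimal (lower a)) }) ,
  (λ { _ (b , _ , refl) → isMax-encode (Raising.vertex-maximal (raise b)) }) ,
  coverGraphByAddingLeaves , isHeight-preserved ,
  (λ { _ (b , b∈B , refl) → b , b∈B , raised-≥ b }) ,
  (λ { _ (a , a∈A , refl) → a , a∈A , lowered-≤ a }) ,
  λ _ _ → isDim-mono embedding lowered raised lowered-≤ raised-≥ inc⇒inc
  where
  open LeafExtension P
  A′ B′ : Subset poset
  A′ z = ∃ λ a → A a × lowered a ≡ z
  B′ z = ∃ λ b → B b × raised b ≡ z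
  inc⇒inc : ∀ a b → Inc P A B a b → Inc poset A′ B′ (lowered a) (raised b)
  inc⇒inc a b (a∈A , b∈B , a∥b) = (a , a∈A , refl) , (b , b∈B , refl) , incomparable-lowered-raised a∥b
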